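{- Let $\mathcal{M}$ be an $S5^\forall_\equiv$-model and $\gamma\colon V\rightarrow M$ an assignment. There exist a Kripke frame $(W,R)$ of modal logic $S5$, a valuation $g\colon V\rightarrow Pow(W)$ and a world $w\in W$ such that for all $\varphi,\psi\in Fm_m$: $(\mathcal{M},\gamma)\vDash\varphi\Leftrightarrow(w,g)\vDash\varphi$, and $(\mathcal{M},\gamma)\vDash\varphi\equiv\psi\Rightarrow(w,g)\vDash\square(\varphi\leftrightarrow\psi)$; moreover, if $\mathcal{M}$ satisfies the Collapse Axiom and is a Boolean algebra, the latter implication is a biconditional.
   Context: Language: $Fm(C)$ is the set of formulas built from propositional variables $V$, a set $C$ of constants containing $\top,\bot$, connectives $\neg,\rightarrow,\vee,\wedge$, identity connective $\equiv$, necessity $\square$ and universal propositional quantifier $\forall$. $Fm_m\subseteq Fm(C)$ is the set of formulas of basic modal logic: quantifier-free, without $\equiv$, and with no constants other than $\bot,\top$. The Collapse Axiom is $(\square\varphi\wedge\square\psi)\rightarrow(\varphi\equiv\psi)$. Frames of $S5$ are Kripke frames with $R$ an equivalence relation, with the usual Kripke satisfaction. Models: a propositional domain is $\mathcal{M}=(M,\mathit{TRUE},\mathit{NEC},f_\bot,f_\top,f_\square,f_\neg,f_\vee,f_\wedge,f_\rightarrow,f_\equiv,f_\forall,\varGamma)$ with $\mathit{TRUE},\mathit{NEC}\subseteq M$, operations of obvious arities, $f_\forall\colon M^M\to M$, $\varGamma\colon C\to M$ with $\varGamma(\bot)=f_\bot,\varGamma(\top)=f_\top$; assignments $\gamma\colon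 V\to M$ extend homomorphically with $\gamma(c)=\varGamma(c)$ and $\gamma(\forall x\varphi)=f_\forall(m\mapsto\gamma_x^m(\varphi))$. $t\colon M\to M$ is $(\varphi,x,\gamma)$-definable if $t(m)=\gamma_x^m(\varphi)$ for all $m$ (definable if so for some $\varphi,x,\gamma$). With $a\le_\mathcal{M}b:\Leftrightarrow f_\rightarrow(a,b)\in\mathit{NEC}$ and $\approx_\mathcal{M}$ its symmetric part, $\mathcal{M}$ is an $S3^\forall_\equiv$-model if: (1) when $\mathit{NEC}\neq\varnothing$, $\le_\mathcal{M}$ is a preorder making $(M,f_\bot,f_\top,f_\neg,f_\vee,f_\wedge,f_\rightarrow,\le_\mathcal{M})$ a Boolean prealgebra ($\approx_\mathcal{M}$ a congruence with Boolean-algebra quotient ordered by $\le_\mathcal{M}$); (2) $f_\bot\notin\mathit{TRUE}$, $f_\top\in\mathit{TRUE}$, classical truth conditions for $f_\rightarrow,f_\neg,f_\wedge,f_\vee$, $f_\square(a)\in\mathit{TRUE}\Leftrightarrow a\in\mathit{NEC}$, $f_\equiv(a,b)\in\mathit{TRUE}\Leftrightarrow a=b$, $f_\forall(t)\in\mathit{TRUE}$ for definable $t$ with image in $\mathit{TRUE}$; (3) when $\mathit{NEC}\neq\varnothing$, $\mathit{NEC}\subseteq\mathit{TRUE}$ is upward closed under $\le_\mathcal{M}$ and closed under $f_\wedge$; (4) when $\mathit{NEC}\neq\varnothing$: $f_\top\le_\mathcal{M}f_\equiv(a,a)$; $f_\equiv(a,b)\le_\mathcal{M}f_\rightarrow(a,b)$;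 $f_\equiv(a,b)\le_\mathcal{M}f_\equiv(t(a),t(b))$ for definable $t$; $f_\square(a)\le_\mathcal{M}a$; $f_\square(f_\rightarrow(a,b))\le_\mathcal{M}f_\rightarrow(f_\square(a),f_\square(b))$; $f_\square(f_\rightarrow(a,b))\le_\mathcal{M}f_\square(f_\rightarrow(f_\square(a),f_\square(b)))$; $f_\forall(t)\le_\mathcal{M}f_\equiv(f_\forall(t_1),f_\forall(t_2))$ and $f_\forall(t)\le_\mathcal{M}f_\rightarrow(f_\forall(t_1),f_\forall(t_2))$ for $t_1,t_2$ $(\varphi,x,\gamma)$-, $(\psi,x,\gamma)$-definable and $t$ the pointwise $f_\equiv$, resp. $f_\rightarrow$, of $t_1,t_2$; $f_\forall(t)\le_\mathcal{M}t(a)$ for definable $t$; $f_\forall(t)\le_\mathcal{M}f_\rightarrow(b,f_\forall(t'))$ for $t'$ $(\psi,x,\gamma)$-definable, $b$ the denotation of a sentence and $t(a)=f_\rightarrow(b,t'(a))$; $f_\square(f_\forall(t))\approx_\mathcal{M}f_\forall(a\mapsto f_\square(t(a)))$ for definable $t$; $f_\forall(t)\in\mathit{NEC}$ for definable $t$ with image in $\mathit{NEC}$. It is normal if $\mathit{NEC}\neq\varnothing$. A normal $S3^\forall_\equiv$-model is an $S4^\forall_\equiv$-model if $f_\square(a)\le_\mathcal{M}f_\square(f_\square(a))$ for all $a$; an $S4^\forall_\equiv$-model is an $S5^\forall_\equiv$-model if additionally $f_\neg(f_\square(a))\le_\mathcal{M}f_\square(f_\neg(f_\square(a)))$ for all $a$.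 $(\mathcal{M},\gamma)\vDash\varphi:\Leftrightarrow\gamma(\varphi)\in\mathit{TRUE}$. -}

module Defs where

open import Data.Nat using (ℕ; _≡ᵇ_)
open import Data.Bool using (if_then_else_)
open import Data.Product using (Σ; Σ-syntax; _×_; _,_)
open import Data.Sum using (_⊎_)
open import Data.Empty using (⊥)
open import Data.Unit using (⊤)
open import Relation.Nullary using (¬_)
open import Relation.Binary.PropositionalEquality using (_≡_)
open import Relation.Binary.Structures using (IsEquivalence)

infix 2 _⇔_
_⇔_ : Set → Set → Set
A ⇔ B = (A → B) × (B → A)

Var : Set
Var = ℕ

data Fm (C : Set) : Set where
  var  : Var → Fm C
  con  : C → Fm C          -- constants of C other than ⊤, ⊥
  bot  : Fm C
  top  : Fm C
  neg  : Fm C → Fm C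
  imp  : Fm C → Fm C → Fm C
  or   : Fm C → Fm C → Fm C
  and  : Fm C → Fm C → Fm C
  eqv  : Fm C → Fm C → Fm C   -- identity connective ≡
  box  : Fm C → Fm C
  all  : Var → Fm C → Fm C

data FreeIn {C : Set} (x : Var) : Fm C → Set where
  fv     : FreeIn x (var x)
  fneg   : ∀ {φ} → FreeIn x φ → FreeIn x (neg φ)
  fimpl  : ∀ {φ ψ} → FreeIn x φ → FreeIn x (imp φ ψ)
  fimpr  : ∀ {φ ψ} → FreeIn x ψ → FreeIn x (imp φ ψ)
  forl   : ∀ {φ ψ} → FreeIn x φ → FreeIn x (or φ ψ)
  forr   : ∀ {φ ψ} → FreeIn x ψ → FreeIn x (or φ ψ)
  fandl  : ∀ {φ ψ} → FreeIn x φ → FreeIn x (and φ ψ)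
  fandr  : ∀ {φ ψ} → FreeIn x ψ → FreeIn x (and φ ψ)
  feqvl  : ∀ {φ ψ} → FreeIn x φ → FreeIn x (eqv φ ψ)
  feqvr  : ∀ {φ ψ} → FreeIn x ψ → FreeIn x (eqv φ ψ)
  fbox   : ∀ {φ} → FreeIn x φ → FreeIn x (box φ)
  fall   : ∀ {y φ} → ¬ (x ≡ y) → FreeIn x φ → FreeIn x (all y φ)

Sentence : {C : Set} → Fm C → Set
Sentence φ = ∀ x → ¬ FreeIn x φ

data MFm : Set where
  var  : Var → MFm
  bot  : MFm
  top  : MFm
  neg  : MFm → MFm
  imp  : MFm → MFm → MFm
  or   : MFm → MFm → MFm
  and  : MFm → MFm → MFm
  box  : MFm → MFm

ι : {C : Set} → MFm → Fm C
ι (var x)   = var x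
ι bot       = bot
ι top       = top
ι (neg φ)   = neg (ι φ)
ι (imp φ ψ) = imp (ι φ) (ι ψ)
ι (or φ ψ)  = or (ι φ) (ι ψ)
ι (and φ ψ) = and (ι φ) (ι ψ)
ι (box φ)   = box (ι φ)

iff : MFm → MFm → MFm
iff φ ψ = and (imp φ ψ) (imp ψ φ)

record PropDomain (C : Set) : Set₁ where
  field
    M    : Set
    TRUE : M → Set
    NEC  : M → Set
    f⊥ f⊤ : M
    f□ f¬ : M → M
    f∨ f∧ f→ f≡ : M → M → M
    f∀   : (M → M) → M
    Γ    : C → M      -- Γ(⊥) = f⊥, Γ(⊤) = f⊤ are built into the syntax

  Assignment : Set
  Assignment = Var → M

  _[_↦_] : Assignment → Var → M → Assignment
  (γ [ x ↦ m ]) y = if x ≡ᵇ y then m else γ y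

  ⟦_⟧ : Fm C → Assignment → M
  ⟦ var x ⟧ γ   = γ x
  ⟦ con c ⟧ γ   = Γ c
  ⟦ bot ⟧ γ     = f⊥
  ⟦ top ⟧ γ     = f⊤
  ⟦ neg φ ⟧ γ   = f¬ (⟦ φ ⟧ γ)
  ⟦ imp φ ψ ⟧ γ = f→ (⟦ φ ⟧ γ) (⟦ ψ ⟧ γ)
  ⟦ or φ ψ ⟧ γ  = f∨ (⟦ φ ⟧ γ) (⟦ ψ ⟧ γ)
  ⟦ and φ ψ ⟧ γ = f∧ (⟦ φ ⟧ γ) (⟦ ψ ⟧ γ)
  ⟦ eqv φ ψ ⟧ γ = f≡ (⟦ φ ⟧ γ) (⟦ ψ ⟧ γ)
  ⟦ box φ ⟧ γ   = f□ (⟦ φ ⟧ γ)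
  ⟦ all x φ ⟧ γ = f∀ (λ m → ⟦ φ ⟧ (γ [ x ↦ m ]))

  _⊨_ : Assignment → Fm C → Set
  γ ⊨ φ = TRUE (⟦ φ ⟧ γ)

  DefBy : (M → M) → Fm C → Var → Assignment → Set
  DefBy t φ x γ = ∀ m → t m ≡ ⟦ φ ⟧ (γ [ x ↦ m ])

  Definable : (M → M) → Set
  Definable t = Σ[ φ ∈ Fm C ] Σ[ x ∈ Var ] Σ[ γ ∈ Assignment ] DefBy t φ x γ

  SentenceDenotation : M → Set
  SentenceDenotation b =
    Σ[ χ ∈ Fm C ] Σ[ δ ∈ Assignment ] (Sentence χ × (b ≡ ⟦ χ ⟧ δ))

  _≤_ : M → M → Set
  a ≤ b = NEC (f→ a b)

  _≈_ : M → M → Set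
  a ≈ b = (a ≤ b) × (b ≤ a)

  Normal : Set
  Normal = Σ M NEC

  record IsBooleanPrealgebra : Set where
    field
      refl≤   : ∀ a → a ≤ a
      trans≤  : ∀ {a b c} → a ≤ b → b ≤ c → a ≤ c
      cong¬   : ∀ {a a'} → a ≈ a' → f¬ a ≈ f¬ a'
      cong∨   : ∀ {a a' b b'} → a ≈ a' → b ≈ b' → f∨ a b ≈ f∨ a' b'
      cong∧   : ∀ {a a' b b'} → a ≈ a' → b ≈ b' → f∧ a b ≈ f∧ a' b'
      cong→   : ∀ {a a' b b'} → a ≈ a' → b ≈ b' → f→ a b ≈ f→ a' b'
      ∧-lb₁   : ∀ a b → f∧ a b ≤ a
      ∧-lb₂   : ∀ a b → f∧ a b ≤ b
      ∧-glb   : ∀ {a b c} → c ≤ a → c ≤ b → c ≤ f∧ a b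
      ∨-ub₁   : ∀ a b → a ≤ f∨ a b
      ∨-ub₂   : ∀ a b → b ≤ f∨ a b
      ∨-lub   : ∀ {a b c} → a ≤ c → b ≤ c → f∨ a b ≤ c
      ⊥-least : ∀ a → f⊥ ≤ a
      ⊤-great : ∀ a → a ≤ f⊤
      distrib : ∀ a b c → f∧ a (f∨ b c) ≤ f∨ (f∧ a b) (f∧ a c)
      compl∧  : ∀ a → f∧ a (f¬ a) ≤ f⊥
      compl∨  : ∀ a → f⊤ ≤ f∨ a (f¬ a)
      →-def   : ∀ a b → f→ a b ≈ f∨ (f¬ a) b

  IsBooleanAlgebra : Set
  IsBooleanAlgebra = IsBooleanPrealgebra × (∀ {a b} → a ≈ b → a ≡ b)

  record IsS3Model : Set where
    field
      prealg  : Normal → IsBooleanPrealgebra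
      ⊥-false : ¬ TRUE f⊥
      ⊤-true  : TRUE f⊤
      →-true  : ∀ a b → TRUE (f→ a b) ⇔ (TRUE a → TRUE b)
      ¬-true  : ∀ a → TRUE (f¬ a) ⇔ (¬ TRUE a)
      ∧-true  : ∀ a b → TRUE (f∧ a b) ⇔ (TRUE a × TRUE b)
      ∨-true  : ∀ a b → TRUE (f∨ a b) ⇔ (TRUE a ⊎ TRUE b)
      □-true  : ∀ a → TRUE (f□ a) ⇔ NEC a
      ≡-true  : ∀ a b → TRUE (f≡ a b) ⇔ (a ≡ b)
      ∀-true  : ∀ t → Definable t → (∀ m → TRUE (t m)) → TRUE (f∀ t)
      nec-true : Normal → ∀ {a} → NEC a → TRUE a
      nec-up   : Normal → ∀ {a b} → NEC a → a ≤ b → NEC b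
      nec-∧    : Normal → ∀ {a b} → NEC a → NEC b → NEC (f∧ a b)
      ax-refl  : Normal → ∀ a → f⊤ ≤ f≡ a a
      ax-≡→    : Normal → ∀ a b → f≡ a b ≤ f→ a b
      ax-subst : Normal → ∀ t → Definable t → ∀ a b →
                 f≡ a b ≤ f≡ (t a) (t b)
      ax-T     : Normal → ∀ a → f□ a ≤ a
      ax-K     : Normal → ∀ a b → f□ (f→ a b) ≤ f→ (f□ a) (f□ b)
      ax-S3    : Normal → ∀ a b →
                 f□ (f→ a b) ≤ f□ (f→ (f□ a) (f□ b))
      ax-∀≡    : Normal → ∀ φ ψ x γ t₁ t₂ t →
                 DefBy t₁ φ x γ → DefBy t₂ ψ x γ →
                 (∀ m → t m ≡ f≡ (t₁ m) (t₂ m)) →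
                 f∀ t ≤ f≡ (f∀ t₁) (f∀ t₂)
      ax-∀→    : Normal → ∀ φ ψ x γ t₁ t₂ t →
                 DefBy t₁ φ x γ → DefBy t₂ ψ x γ →
                 (∀ m → t m ≡ f→ (t₁ m) (t₂ m)) →
                 f∀ t ≤ f→ (f∀ t₁) (f∀ t₂)
      ax-inst  : Normal → ∀ t → Definable t → ∀ a → f∀ t ≤ t a
      ax-vac   : Normal → ∀ ψ x γ t' t b →
                 DefBy t' ψ x γ → SentenceDenotation b →
                 (∀ a → t a ≡ f→ b (t' a)) →
                 f∀ t ≤ f→ b (f∀ t')
      ax-BF    : Normal → ∀ t → Definable t →
                 f□ (f∀ t) ≈ f∀ (λ a → f□ (t a))
      ax-∀nec  : Normal → ∀ t → Definable t → (∀ a → NEC (t a)) →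
                 NEC (f∀ t)

  record IsS5Model : Set where
    field
      s3     : IsS3Model
      normal : Normal
      ax-4   : ∀ a → f□ a ≤ f□ (f□ a)
      ax-5   : ∀ a → f¬ (f□ a) ≤ f□ (f¬ (f□ a))

  SatisfiesCollapse : Set
  SatisfiesCollapse = ∀ (γ : Assignment) (φ ψ : Fm C) →
    γ ⊨ imp (and (box φ) (box ψ)) (eqv φ ψ)

record S5Frame : Set₁ where
  field
    W     : Set
    R     : W → W → Set
    R-equiv : IsEquivalence R

open S5Frame public

Valuation : S5Frame → Set₁
Valuation F = Var → W F → Set

sat : (F : S5Frame) → Valuation F → W F → MFm → Set
sat F g w (var x)   = g x w
sat F g w bot       = ⊥
sat F g w top       = ⊤
sat F g w (neg φ)   = ¬ sat F g w φ
sat F g w (imp φ ψ) = sat F g w φ → sat F g w ψ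
sat F g w (or φ ψ)  = sat F g w φ ⊎ sat F g w ψ
sat F g w (and φ ψ) = sat F g w φ × sat F g w ψ
sat F g w (box φ)   = ∀ v → R F w v → sat F g v φ

-- Worlds of the canonical frame are the Boolean valuations of the variables
-- that satisfy every formula necessary in 𝓜 (boxed subformulas being read off
-- 𝓜), related universally; the actual world is truth in 𝓜 under γ. As every
-- □φ is necessary or necessarily false in an S5 model, the truth lemma reduces
-- to: if ⟪φ⟫ is not necessary, some admissible valuation refutes φ. It is built
-- Lindenbaum-style in the Boolean prealgebra, deciding the variables one at a
-- time below the consistent element ¬⟪φ⟫.

module Submission where

open import Defs
open import Data.Bool using (Bool; true; false; T)
open import Data.Empty using (⊥; ⊥-elim)
open import Data.Nat using (ℕ; zero; suc; _⊔_; _≤′_; ≤′-reflexive; ≤′-step) renaming (_≤_ to _≤ℕ_)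
open import Data.Nat.Properties using (≤⇒≤′; z≤′n; m⊔n≤o⇒m≤o; m⊔n≤o⇒n≤o; ≤-refl)
open import Data.Product as Product using (Σ; Σ-syntax; _×_; _,_; proj₁; proj₂)
open import Data.Sum as Sum using (_⊎_; inj₁; inj₂)
open import Data.Unit using (⊤; tt)
open import Relation.Binary.Bundles using (Preorder)
open import Relation.Binary.Construct.Always as Always using (Always)
open import Relation.Binary.PropositionalEquality using (_≡_; refl; isEquivalence)
open import Relation.Nullary using (¬_; Dec; yes; no)
open import Relation.Nullary.Decidable using (isYes; isNo; toWitness; fromWitness)
import Relation.Binary.Reasoning.Preorder as PreorderReasoning

⇔-refl : {A : Set} → A ⇔ A
⇔-refl = (λ a → a) , (λ a → a)

⇔-sym : {A B : Set} → A ⇔ B → B ⇔ A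
⇔-sym (f , g) = g , f

⇔-trans : {A B D : Set} → A ⇔ B → B ⇔ D → A ⇔ D
⇔-trans (f , g) (f' , g') = (λ a → f' (f a)) , (λ d → g (g' d))

¬-cong : {A B : Set} → A ⇔ B → (¬ A) ⇔ (¬ B)
¬-cong (f , g) = (λ ¬a b → ¬a (g b)) , (λ ¬b a → ¬b (f a))

→-cong : {A B D E : Set} → A ⇔ B → D ⇔ E → (A → D) ⇔ (B → E)
→-cong (f , g) (f' , g') = (λ h b → f' (h (g b))) , (λ h a → g' (h (f a)))

⊎-cong : {A B D E : Set} → A ⇔ B → D ⇔ E → (A ⊎ D) ⇔ (B ⊎ E)
⊎-cong (f , g) (f' , g') = Sum.map f f' , Sum.map g g'

×-cong : {A B D E : Set} → A ⇔ B → D ⇔ E → (A × D) ⇔ (B × E)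
×-cong (f , g) (f' , g') = Product.map f f' , Product.map g g'

module BooleanPrealgebraProperties {C : Set} (𝓜 : PropDomain C)
                                   (B : PropDomain.IsBooleanPrealgebra 𝓜) where
  open PropDomain 𝓜
  open IsBooleanPrealgebra B

  ≤-preorder : Preorder _ _ _
  ≤-preorder = record
    { Carrier = M ; _≈_ = _≡_ ; _≲_ = _≤_
    ; isPreorder = record
      { isEquivalence = isEquivalence
      ; reflexive = λ { refl → refl≤ _ }
      ; trans = trans≤ } }

  open PreorderReasoning ≤-preorder

  Consistent : M → Set
  Consistent d = ¬ (d ≤ f⊥)

  Decides : Set → M → M → Set
  Decides S d a = (S × d ≤ a) ⊎ (¬ S × d ≤ f¬ a)

  d≤d∧[a∨¬a] : ∀ d a → d ≤ f∧ d (f∨ a (f¬ a))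
  d≤d∧[a∨¬a] d a = ∧-glb (refl≤ d) (trans≤ (⊤-great d) (compl∨ a))

  d∧a≤⊥⇒d∧¬a≤⊥⇒d≤⊥ : ∀ {d a} → f∧ d a ≤ f⊥ → f∧ d (f¬ a) ≤ f⊥ → d ≤ f⊥
  d∧a≤⊥⇒d∧¬a≤⊥⇒d≤⊥ {d} {a} p q = begin
    d                                ≲⟨ d≤d∧[a∨¬a] d a ⟩
    f∧ d (f∨ a (f¬ a))               ≲⟨ distrib d a (f¬ a) ⟩
    f∨ (f∧ d a) (f∧ d (f¬ a))        ≲⟨ ∨-lub p q ⟩
    f⊥                               ∎

  a∧b≤⊥⇒a≤¬b : ∀ {a b} → f∧ a b ≤ f⊥ → a ≤ f¬ b
  a∧b≤⊥⇒a≤¬b {a} {b} p = begin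
    a                                ≲⟨ d≤d∧[a∨¬a] a b ⟩
    f∧ a (f∨ b (f¬ b))               ≲⟨ distrib a b (f¬ b) ⟩
    f∨ (f∧ a b) (f∧ a (f¬ b))        ≲⟨ ∨-lub (trans≤ p (⊥-least _)) (∧-lb₂ a (f¬ b)) ⟩
    f¬ b                             ∎

  c≤a⇒c≤¬a⇒c≤⊥ : ∀ {c a} → c ≤ a → c ≤ f¬ a → c ≤ f⊥
  c≤a⇒c≤¬a⇒c≤⊥ {a = a} p q = trans≤ (∧-glb p q) (compl∧ a)

  a≤b⇒¬b≤¬a : ∀ {a b} → a ≤ b → f¬ b ≤ f¬ a
  a≤b⇒¬b≤¬a p = a∧b≤⊥⇒a≤¬b (c≤a⇒c≤¬a⇒c≤⊥ (trans≤ (∧-lb₂ _ _) p) (∧-lb₁ _ _))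

  a≤¬¬a : ∀ a → a ≤ f¬ (f¬ a)
  a≤¬¬a a = a∧b≤⊥⇒a≤¬b (compl∧ a)

  ⊤≤¬⊥ : f⊤ ≤ f¬ f⊥
  ⊤≤¬⊥ = a∧b≤⊥⇒a≤¬b (∧-lb₂ _ _)

  ¬a∧¬b≤¬[a∨b] : ∀ a b → f∧ (f¬ a) (f¬ b) ≤ f¬ (f∨ a b)
  ¬a∧¬b≤¬[a∨b] a b = a∧b≤⊥⇒a≤¬b (begin
    f∧ (f∧ (f¬ a) (f¬ b)) (f∨ a b)                    ≲⟨ distrib _ a b ⟩
    f∨ (f∧ (f∧ (f¬ a) (f¬ b)) a) (f∧ (f∧ (f¬ a) (f¬ b)) b)
      ≲⟨ ∨-lub (c≤a⇒c≤¬a⇒c≤⊥ (∧-lb₂ _ _) (trans≤ (∧-lb₁ _ _) (∧-lb₁ _ _)))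
               (c≤a⇒c≤¬a⇒c≤⊥ (∧-lb₂ _ _) (trans≤ (∧-lb₁ _ _) (∧-lb₂ _ _))) ⟩
    f⊥                                                ∎)

  a∧¬b≤¬[a→b] : ∀ a b → f∧ a (f¬ b) ≤ f¬ (f→ a b)
  a∧¬b≤¬[a→b] a b = begin
    f∧ a (f¬ b)                ≲⟨ a∧b≤⊥⇒a≤¬b (begin
      f∧ (f∧ a (f¬ b)) (f∨ (f¬ a) b)    ≲⟨ distrib _ (f¬ a) b ⟩
      f∨ (f∧ (f∧ a (f¬ b)) (f¬ a)) (f∧ (f∧ a (f¬ b)) b)
        ≲⟨ ∨-lub (c≤a⇒c≤¬a⇒c≤⊥ (trans≤ (∧-lb₁ _ _) (∧-lb₁ _ _)) (∧-lb₂ _ _))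
                 (c≤a⇒c≤¬a⇒c≤⊥ (∧-lb₂ _ _) (trans≤ (∧-lb₁ _ _) (∧-lb₂ _ _))) ⟩
      f⊥                                ∎) ⟩
    f¬ (f∨ (f¬ a) b)           ≲⟨ proj₂ (cong¬ (→-def a b)) ⟩
    f¬ (f→ a b)                ∎

  ¬a≤a→b : ∀ a b → f¬ a ≤ f→ a b
  ¬a≤a→b a b = trans≤ (∨-ub₁ (f¬ a) b) (proj₂ (→-def a b))

  b≤a→b : ∀ a b → b ≤ f→ a b
  b≤a→b a b = trans≤ (∨-ub₂ (f¬ a) b) (proj₂ (→-def a b))

  literal : Bool → M → M
  literal true  a = a
  literal false a = f¬ a

  decides-literal : ∀ b d a → Decides (T b) (f∧ d (literal b a)) a
  decides-literal true  d a = inj₁ (tt , ∧-lb₂ d a)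
  decides-literal false d a = inj₂ ((λ ()) , ∧-lb₂ d (f¬ a))

  -- keep a unless it is inconsistent with d, in which case ¬ a is consistent with d
  consistent-literal : ∀ {d a} (δ : Dec (f∧ d a ≤ f⊥)) → Consistent d →
                       Consistent (f∧ d (literal (isNo δ) a))
  consistent-literal (yes d∧a≤⊥) d≰⊥ d∧¬a≤⊥ = d≰⊥ (d∧a≤⊥⇒d∧¬a≤⊥⇒d≤⊥ d∧a≤⊥ d∧¬a≤⊥)
  consistent-literal (no d∧a≰⊥)  _          = d∧a≰⊥

  decides-antitone : ∀ {S d d' a} → d' ≤ d → Decides S d a → Decides S d' a
  decides-antitone p = Sum.map (Product.map₂ (trans≤ p)) (Product.map₂ (trans≤ p))

  decides-true : ∀ {S d a} → Consistent d → d ≤ a → Decides S d a → S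
  decides-true _   _   (inj₁ (s , _))    = s
  decides-true d≰⊥ d≤a (inj₂ (_ , d≤¬a)) = ⊥-elim (d≰⊥ (c≤a⇒c≤¬a⇒c≤⊥ d≤a d≤¬a))

  decides-false : ∀ {S d a} → Consistent d → d ≤ f¬ a → Decides S d a → ¬ S
  decides-false d≰⊥ d≤¬a (inj₁ (_ , d≤a)) = ⊥-elim (d≰⊥ (c≤a⇒c≤¬a⇒c≤⊥ d≤a d≤¬a))
  decides-false _   _    (inj₂ (¬s , _))  = ¬s

  decides-⊥ : ∀ d → Decides ⊥ d f⊥
  decides-⊥ d = inj₂ ((λ ()) , trans≤ (⊤-great d) ⊤≤¬⊥)

  decides-⊤ : ∀ d → Decides ⊤ d f⊤
  decides-⊤ d = inj₁ (tt , ⊤-great d)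

  decides-¬ : ∀ {S d a} → Decides S d a → Decides (¬ S) d (f¬ a)
  decides-¬ (inj₁ (s , p))  = inj₂ ((λ ¬s → ¬s s) , trans≤ p (a≤¬¬a _))
  decides-¬ (inj₂ (¬s , p)) = inj₁ (¬s , p)

  decides-→ : ∀ {S T d a b} → Decides S d a → Decides T d b → Decides (S → T) d (f→ a b)
  decides-→ (inj₂ (¬s , p)) _              = inj₁ ((λ s → ⊥-elim (¬s s)) , trans≤ p (¬a≤a→b _ _))
  decides-→ (inj₁ _)       (inj₁ (t , q))  = inj₁ ((λ _ → t) , trans≤ q (b≤a→b _ _))
  decides-→ (inj₁ (s , p)) (inj₂ (¬t , q)) = inj₂ ((λ f → ¬t (f s)) , trans≤ (∧-glb p q) (a∧¬b≤¬[a→b] _ _))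

  decides-∨ : ∀ {S T d a b} → Decides S d a → Decides T d b → Decides (S ⊎ T) d (f∨ a b)
  decides-∨ (inj₁ (s , p))  _                = inj₁ (inj₁ s , trans≤ p (∨-ub₁ _ _))
  decides-∨ (inj₂ _)        (inj₁ (t , q))   = inj₁ (inj₂ t , trans≤ q (∨-ub₂ _ _))
  decides-∨ (inj₂ (¬s , p)) (inj₂ (¬t , q))  =
    inj₂ (Sum.[ ¬s , ¬t ] , trans≤ (∧-glb p q) (¬a∧¬b≤¬[a∨b] _ _))

  decides-∧ : ∀ {S T d a b} → Decides S d a → Decides T d b → Decides (S × T) d (f∧ a b)
  decides-∧ (inj₂ (¬s , p)) _                = inj₂ ((λ st → ¬s (proj₁ st)) , trans≤ p (a≤b⇒¬b≤¬a (∧-lb₁ _ _)))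
  decides-∧ (inj₁ _)        (inj₂ (¬t , q))  = inj₂ ((λ st → ¬t (proj₂ st)) , trans≤ q (a≤b⇒¬b≤¬a (∧-lb₂ _ _)))
  decides-∧ (inj₁ (s , p))  (inj₁ (t , q))   = inj₁ ((s , t) , ∧-glb p q)

module NormalS3ModelProperties {C : Set} (𝓜 : PropDomain C) (s3 : PropDomain.IsS3Model 𝓜)
                               (normal : PropDomain.Normal 𝓜) where
  open PropDomain 𝓜
  open IsS3Model s3
  open IsBooleanPrealgebra (prealg normal) public
  open BooleanPrealgebraProperties 𝓜 (prealg normal) public

  nec-⊤ : NEC f⊤
  nec-⊤ = nec-up normal (proj₂ normal) (⊤-great (proj₁ normal))

  ≤-nec : ∀ {c} d → NEC c → d ≤ c
  ≤-nec d nec-c = nec-up normal nec-c (b≤a→b d _)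

  -- excluded middle is valid in the model, since a ∨ ¬a is necessary
  TRUE-dec : ∀ a → Dec (TRUE a)
  TRUE-dec a with proj₁ (∨-true a (f¬ a))
                   (proj₁ (→-true _ _) (nec-true normal (compl∨ a)) ⊤-true)
  ... | inj₁ a-true  = yes a-true
  ... | inj₂ ¬a-true = no (proj₁ (¬-true a) ¬a-true)

  NEC-dec : ∀ a → Dec (NEC a)
  NEC-dec a with TRUE-dec (f□ a)
  ... | yes □a-true = yes (proj₁ (□-true a) □a-true)
  ... | no □a-false = no (λ nec-a → □a-false (proj₂ (□-true a) nec-a))

  ¬nec⇒consistent¬ : ∀ {a} → ¬ NEC a → Consistent (f¬ a)
  ¬nec⇒consistent¬ {a} ¬nec ¬a≤⊥ =
    ¬nec (nec-up normal nec-⊤ (trans≤ (compl∨ a) (∨-lub (refl≤ a) (trans≤ ¬a≤⊥ (⊥-least a)))))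

  identity⇒nec↔ : ∀ {a b} → TRUE (f≡ a b) → NEC (f∧ (f→ a b) (f→ b a))
  identity⇒nec↔ {a} a≡b-true with proj₁ (≡-true a _) a≡b-true
  ... | refl = nec-∧ normal (refl≤ a) (refl≤ a)

  nec↔⇒≈ : ∀ {a b} → NEC (f∧ (f→ a b) (f→ b a)) → a ≈ b
  nec↔⇒≈ nec-↔ = nec-up normal nec-↔ (∧-lb₁ _ _) , nec-up normal nec-↔ (∧-lb₂ _ _)

module S5ModelProperties {C : Set} (𝓜 : PropDomain C) (s5 : PropDomain.IsS5Model 𝓜) where
  open PropDomain 𝓜
  open IsS5Model s5
  open IsS3Model s3
  open NormalS3ModelProperties 𝓜 s3 normal public

  nec⇒nec□ : ∀ {a} → NEC a → NEC (f□ a)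
  nec⇒nec□ {a} nec-a = proj₁ (□-true (f□ a))
    (proj₁ (→-true _ _) (nec-true normal (ax-4 a)) (proj₂ (□-true a) nec-a))

  ¬nec⇒nec¬□ : ∀ {a} → ¬ NEC a → NEC (f¬ (f□ a))
  ¬nec⇒nec¬□ {a} ¬nec-a = proj₁ (□-true _)
    (proj₁ (→-true _ _) (nec-true normal (ax-5 a))
      (proj₂ (¬-true _) (λ □a-true → ¬nec-a (proj₁ (□-true a) □a-true))))

module CanonicalModel {C : Set} (𝓜 : PropDomain C) (s5 : PropDomain.IsS5Model 𝓜)
                      (γ : PropDomain.Assignment 𝓜) where
  open PropDomain 𝓜
  open IsS5Model s5
  open IsS3Model s3
  open S5ModelProperties 𝓜 s5

  ⟪_⟫ : MFm → M
  ⟪ φ ⟫ = ⟦ ι φ ⟧ γ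

  _⊩_ : (Var → Bool) → MFm → Set
  P ⊩ var x   = T (P x)
  P ⊩ bot     = ⊥
  P ⊩ top     = ⊤
  P ⊩ neg φ   = ¬ (P ⊩ φ)
  P ⊩ imp φ ψ = P ⊩ φ → P ⊩ ψ
  P ⊩ or φ ψ  = P ⊩ φ ⊎ P ⊩ ψ
  P ⊩ and φ ψ = P ⊩ φ × P ⊩ ψ
  P ⊩ box φ   = TRUE (f□ ⟪ φ ⟫)

  Admissible : (Var → Bool) → Set
  Admissible P = ∀ φ → NEC ⟪ φ ⟫ → P ⊩ φ

  -- S4 and S5 make every □φ either necessary or necessarily false
  decides-box : ∀ P d φ → Decides (P ⊩ box φ) d ⟪ box φ ⟫
  decides-box P d φ with NEC-dec ⟪ φ ⟫
  ... | yes nec-φ = inj₁ (proj₂ (□-true _) nec-φ , ≤-nec d (nec⇒nec□ nec-φ))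
  ... | no ¬nec-φ = inj₂ ((λ □φ-true → ¬nec-φ (proj₁ (□-true _) □φ-true)) , ≤-nec d (¬nec⇒nec¬□ ¬nec-φ))

  varBound : MFm → ℕ
  varBound (var x)   = suc x
  varBound bot       = 0
  varBound top       = 0
  varBound (neg φ)   = varBound φ
  varBound (imp φ ψ) = varBound φ ⊔ varBound ψ
  varBound (or φ ψ)  = varBound φ ⊔ varBound ψ
  varBound (and φ ψ) = varBound φ ⊔ varBound ψ
  varBound (box φ)   = 0

  module Refutation (c : MFm) (¬nec-c : ¬ NEC ⟪ c ⟫) where
    chain : ℕ → M
    refuter : Var → Bool

    chain zero    = f¬ ⟪ c ⟫
    chain (suc n) = f∧ (chain n) (literal (refuter n) (γ n))

    refuter n = isNo (NEC-dec (f→ (f∧ (chain n) (γ n)) f⊥))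

    chain-consistent : ∀ n → Consistent (chain n)
    chain-consistent zero    = ¬nec⇒consistent¬ ¬nec-c
    chain-consistent (suc n) = consistent-literal (NEC-dec _) (chain-consistent n)

    chain-antitone : ∀ {m n} → m ≤′ n → chain n ≤ chain m
    chain-antitone (≤′-reflexive refl) = refl≤ _
    chain-antitone (≤′-step m≤′n)      = trans≤ (∧-lb₁ _ _) (chain-antitone m≤′n)

    chain-decides : ∀ φ {n} → varBound φ ≤ℕ n → Decides (refuter ⊩ φ) (chain n) ⟪ φ ⟫
    chain-decides (var x) b   =
      decides-antitone (chain-antitone (≤⇒≤′ b)) (decides-literal (refuter x) (chain x) (γ x))
    chain-decides bot _       = decides-⊥ _
    chain-decides top _       = decides-⊤ _
    chain-decides (neg φ) b   = decides-¬ (chain-decides φ b)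
    chain-decides (imp φ ψ) b =
      decides-→ (chain-decides φ (m⊔n≤o⇒m≤o _ _ b)) (chain-decides ψ (m⊔n≤o⇒n≤o _ _ b))
    chain-decides (or φ ψ) b  =
      decides-∨ (chain-decides φ (m⊔n≤o⇒m≤o _ _ b)) (chain-decides ψ (m⊔n≤o⇒n≤o _ _ b))
    chain-decides (and φ ψ) b =
      decides-∧ (chain-decides φ (m⊔n≤o⇒m≤o _ _ b)) (chain-decides ψ (m⊔n≤o⇒n≤o _ _ b))
    chain-decides (box φ) _   = decides-box refuter _ φ

    refuter-admissible : Admissible refuter
    refuter-admissible φ nec-φ =
      decides-true (chain-consistent (varBound φ)) (≤-nec _ nec-φ) (chain-decides φ ≤-refl)

    refuter-refutes : ¬ (refuter ⊩ c)
    refuter-refutes = decides-false (chain-consistent (varBound c))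
                                    (chain-antitone (z≤′n {varBound c}))
                                    (chain-decides c ≤-refl)

  World : Set
  World = Σ (Var → Bool) Admissible

  frame : S5Frame
  frame = record { W = World ; R = Always ; R-equiv = Always.isEquivalence World _ }

  valuation : Valuation frame
  valuation x (P , _) = T (P x)

  truth : ∀ (w : World) φ → sat frame valuation w φ ⇔ proj₁ w ⊩ φ
  truth w (var x)   = ⇔-refl
  truth w bot       = ⇔-refl
  truth w top       = ⇔-refl
  truth w (neg φ)   = ¬-cong (truth w φ)
  truth w (imp φ ψ) = →-cong (truth w φ) (truth w ψ)
  truth w (or φ ψ)  = ⊎-cong (truth w φ) (truth w ψ)
  truth w (and φ ψ) = ×-cong (truth w φ) (truth w ψ)
  truth w (box φ)   = (λ valid → proj₂ (□-true _) (valid⇒nec valid))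
                    , (λ □φ-true u _ → proj₂ (truth u φ) (proj₂ u φ (proj₁ (□-true _) □φ-true)))
    where
    valid⇒nec : sat frame valuation w (box φ) → NEC ⟪ φ ⟫
    valid⇒nec valid with NEC-dec ⟪ φ ⟫
    ... | yes nec-φ = nec-φ
    ... | no ¬nec-φ = ⊥-elim (refuter-refutes (proj₁ (truth refuting-world φ) (valid refuting-world _)))
      where
      open Refutation φ ¬nec-φ
      refuting-world : World
      refuting-world = refuter , refuter-admissible

  actual : Var → Bool
  actual x = isYes (TRUE-dec (γ x))

  actual-⊩ : ∀ φ → actual ⊩ φ ⇔ TRUE ⟪ φ ⟫
  actual-⊩ (var x)   = toWitness , fromWitness
  actual-⊩ bot       = (λ ()) , ⊥-false
  actual-⊩ top       = (λ _ → ⊤-true) , (λ _ → tt)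
  actual-⊩ (neg φ)   = ⇔-trans (¬-cong (actual-⊩ φ)) (⇔-sym (¬-true _))
  actual-⊩ (imp φ ψ) = ⇔-trans (→-cong (actual-⊩ φ) (actual-⊩ ψ)) (⇔-sym (→-true _ _))
  actual-⊩ (or φ ψ)  = ⇔-trans (⊎-cong (actual-⊩ φ) (actual-⊩ ψ)) (⇔-sym (∨-true _ _))
  actual-⊩ (and φ ψ) = ⇔-trans (×-cong (actual-⊩ φ) (actual-⊩ ψ)) (⇔-sym (∧-true _ _))
  actual-⊩ (box φ)   = ⇔-refl

  actual-world : World
  actual-world = actual , λ φ nec-φ → proj₂ (actual-⊩ φ) (nec-true normal nec-φ)

corollary36 : {C : Set} (𝓜 : PropDomain C) → PropDomain.IsS5Model 𝓜 →
    (γ : PropDomain.Assignment 𝓜) →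
    Σ[ F ∈ S5Frame ] Σ[ g ∈ Valuation F ] Σ[ w ∈ W F ]
      (((φ : MFm) → PropDomain._⊨_ 𝓜 γ (ι φ) ⇔ sat F g w φ)
      × ((φ ψ : MFm) → PropDomain._⊨_ 𝓜 γ (eqv (ι φ) (ι ψ)) →
           sat F g w (box (iff φ ψ)))
      × (PropDomain.SatisfiesCollapse 𝓜 → PropDomain.IsBooleanAlgebra 𝓜 →
           (φ ψ : MFm) → sat F g w (box (iff φ ψ)) →
           PropDomain._⊨_ 𝓜 γ (eqv (ι φ) (ι ψ))))
corollary36 𝓜 s5 γ = frame , valuation , actual-world , agreement , identity⇒□↔ , □↔⇒identity
  where
  open PropDomain 𝓜
  open CanonicalModel 𝓜 s5 γ
  open IsS3Model (IsS5Model.s3 s5) using (≡-true; □-true)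
  open S5ModelProperties 𝓜 s5 using (identity⇒nec↔; nec↔⇒≈)

  agreement : ∀ φ → γ ⊨ ι φ ⇔ sat frame valuation actual-world φ
  agreement φ = ⇔-trans (⇔-sym (actual-⊩ φ)) (⇔-sym (truth actual-world φ))

  identity⇒□↔ : ∀ φ ψ → γ ⊨ eqv (ι φ) (ι ψ) → sat frame valuation actual-world (box (iff φ ψ))
  identity⇒□↔ φ ψ φ≡ψ-true u _ = proj₂ (truth u (iff φ ψ)) (proj₂ u (iff φ ψ) (identity⇒nec↔ φ≡ψ-true))

  □↔⇒identity : SatisfiesCollapse → IsBooleanAlgebra → ∀ φ ψ →
                sat frame valuation actual-world (box (iff φ ψ)) → γ ⊨ eqv (ι φ) (ι ψ)
  □↔⇒identity _ (_ , ≈⇒≡) φ ψ □↔ =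
    proj₂ (≡-true _ _) (≈⇒≡ (nec↔⇒≈ (proj₁ (□-true _) (proj₁ (truth actual-world (box (iff φ ψ))) □↔))))
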